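{- Let $A_k=\{a_1,\dots,a_k\}$ with $1=a_1<a_2<\dots<a_k$ integers, let $h_0$ be the smallest positive integer $h$ with $n(h)\ge a_k$, and let $h\ge h_0$ be an integer. If $x$ is an $h$-gap, then $x<(h_0-1)a_k$.
   Context: For an integer $h\ge 0$, an integer $y\ge 0$ has an $h$-representation if $y=\sum_{i=1}^k c_ia_i$ with nonnegative integers $c_i$ and $\sum_i c_i\le h$. The $h$-range $n(h)$ is the largest integer $n$ such that every integer $0\le y\le n$ has an $h$-representation. For an integer $x$ and integer $h$, put $x_h=x+(h-(h_0-1))a_k$. For an integer $m\ge h_0$, an integer $x>n(h_0-1)$ is called an $m$-gap if $x_h$ has no $h$-representation for every integer $h$ with $h_0-1\le h<m$, but $x_m$ has an $m$-representation (i.e. the gap is "filled in" at level $m$). -}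

module Defs where

open import Data.Nat using (ℕ; zero; suc; _+_; _*_; _∸_; _≤_; _<_)
open import Data.Fin using (Fin; fromℕ)
import Data.Fin as F
open import Data.Product using (Σ; _×_)
open import Relation.Binary.PropositionalEquality using (_≡_)
open import Relation.Nullary using (¬_)

∑ : ∀ {n} → (Fin n → ℕ) → ℕ
∑ {zero}  f = 0
∑ {suc n} f = f F.zero + ∑ (λ i → f (F.suc i))

-- The set A_k = {a_1 < ... < a_k}, indexed by Fin k (index 0 is a_1).
module _ {k : ℕ} (a : Fin k → ℕ) where

  HRep : ℕ → ℕ → Set
  HRep h y = Σ (Fin k → ℕ) λ c → (∑ c ≤ h) × (y ≡ ∑ (λ i → c i * a i))

  -- n is the h-range n(h): the largest n with every 0 ≤ y ≤ n h-representable
  -- (the set of such n is downward closed, so "largest" = n in it, n+1 not)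
  IsRange : ℕ → ℕ → Set
  IsRange h n = (∀ y → y ≤ n → HRep h y) × ¬ (∀ y → y ≤ suc n → HRep h y)

module _ {m : ℕ} (a : Fin (suc m) → ℕ) (n : ℕ → ℕ) (h₀ : ℕ) where

  aₖ : ℕ
  aₖ = a (fromℕ m)

  shift : ℕ → ℕ → ℕ
  shift x h = x + (h ∸ (h₀ ∸ 1)) * aₖ

  -- x is an M-gap (M ≥ h₀ is required separately)
  IsGap : ℕ → ℕ → Set
  IsGap M x = (n (h₀ ∸ 1) < x)
            × (∀ h → h₀ ∸ 1 ≤ h → h < M → ¬ HRep a h (shift x h))
            × HRep a M (shift x M)

module Submission where

-- Write A = a_k for the largest element and H = h₀ - 1.  Let x be
-- an h-gap (h ≥ h₀ ≥ 1, so h = h' + 1 with H ≤ h') and suppose, for a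
-- contradiction, that H·A ≤ x.  Then x_{h'} ≥ h'·A, and x_h = x_{h'} + A has
-- an h-representation c.  Because A is the strict maximum of A_k:
--   * if c does not use A, then every summand is at most A - 1, so
--     x_h ≤ h·(A - 1) < h·A ≤ x_h, which is impossible;
--   * so c uses A, and removing one copy of A leaves an h'-representation
--     of x_{h'}, contradicting the gap condition at level h' < h.

open import Defs
open import Data.Nat using (ℕ; zero; suc; pred; _+_; _*_; _∸_; _≤_; _<_; z≤n; s≤s; s≤s⁻¹; _<?_)
open import Data.Nat.Properties
open import Data.Fin using (Fin; fromℕ)
import Data.Fin as F
import Data.Fin.Properties as FP
open import Data.Vec.Functional using (updateAt)
open import Data.Vec.Functional.Properties using (updateAt-updates; updateAt-minimal)
open import Data.Product using (_,_)
open import Data.Empty using (⊥-elim)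
open import Relation.Nullary using (yes; no)
open import Relation.Binary.PropositionalEquality

∑-cong : ∀ {k} {f g : Fin k → ℕ} → (∀ i → f i ≡ g i) → ∑ f ≡ ∑ g
∑-cong {zero}  f≡g = refl
∑-cong {suc k} f≡g = cong₂ _+_ (f≡g F.zero) (∑-cong (λ i → f≡g (F.suc i)))

∑-update : ∀ {k} (f g : Fin k → ℕ) (j : Fin k) (d : ℕ)
         → f j + d ≡ g j → (∀ i → i ≢ j → f i ≡ g i) → ∑ f + d ≡ ∑ g
∑-update {suc k} f g F.zero d at-j off-j = begin
  f F.zero + ∑ f′ + d   ≡⟨ +-assoc (f F.zero) (∑ f′) d ⟩
  f F.zero + (∑ f′ + d) ≡⟨ cong (f F.zero +_) (+-comm (∑ f′) d) ⟩
  f F.zero + (d + ∑ f′) ≡⟨ sym (+-assoc (f F.zero) d (∑ f′)) ⟩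
  f F.zero + d + ∑ f′   ≡⟨ cong₂ _+_ at-j (∑-cong (λ i → off-j (F.suc i) (λ ()))) ⟩
  g F.zero + ∑ g′       ∎
  where
  open ≡-Reasoning
  f′ g′ : Fin k → ℕ
  f′ i = f (F.suc i)
  g′ i = g (F.suc i)
∑-update {suc k} f g (F.suc j) d at-j off-j = begin
  f F.zero + ∑ f′ + d   ≡⟨ +-assoc (f F.zero) (∑ f′) d ⟩
  f F.zero + (∑ f′ + d) ≡⟨ cong₂ _+_ (off-j F.zero (λ ())) (∑-update f′ g′ j d at-j off-j′) ⟩
  g F.zero + ∑ g′       ∎
  where
  open ≡-Reasoning
  f′ g′ : Fin k → ℕ
  f′ i = f (F.suc i)
  g′ i = g (F.suc i)
  off-j′ : ∀ i → i ≢ j → f′ i ≡ g′ i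
  off-j′ i i≢j = off-j (F.suc i) (λ eq → i≢j (FP.suc-injective eq))

∑-weighted-≤ : ∀ {k} (c a : Fin k → ℕ) (B : ℕ)
             → (∀ i → c i * a i ≤ c i * B) → ∑ (λ i → c i * a i) ≤ ∑ c * B
∑-weighted-≤ {zero}  c a B bound = z≤n
∑-weighted-≤ {suc k} c a B bound = begin
  c F.zero * a F.zero + ∑ (λ i → c (F.suc i) * a (F.suc i))
    ≤⟨ +-mono-≤ (bound F.zero) (∑-weighted-≤ _ _ B (λ i → bound (F.suc i))) ⟩
  c F.zero * B + ∑ (λ i → c (F.suc i)) * B
    ≡⟨ sym (*-distribʳ-+ B (c F.zero) _) ⟩
  ∑ c * B ∎
  where open ≤-Reasoning

pred<self : ∀ {n} → 1 ≤ n → pred n < n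
pred<self {suc n} _ = ≤-refl

peel : ∀ {k} (a : Fin k → ℕ) (j : Fin k)
     → 1 ≤ a j → (∀ i → i ≢ j → a i < a j)
     → ∀ h y → h * a j ≤ y → HRep a (suc h) (y + a j) → HRep a h y
peel a j 1≤aⱼ maximal h y large (c , size , value) with c j in cⱼ
... | suc t = c′ , count , weight
  where
  c′ : Fin _ → ℕ
  c′ = updateAt c j pred

  c′ⱼ : c′ j ≡ t
  c′ⱼ = trans (updateAt-updates j c) (cong pred cⱼ)

  c′-off : ∀ i → i ≢ j → c′ i ≡ c i
  c′-off i i≢j = updateAt-minimal i j c i≢j

  count : ∑ c′ ≤ h
  count = s≤s⁻¹ (subst (_≤ suc h) count-eq size)
    where
    at-j : c′ j + 1 ≡ c j
    at-j = trans (cong (_+ 1) c′ⱼ) (trans (+-comm t 1) (sym cⱼ))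
    count-eq : ∑ c ≡ suc (∑ c′)
    count-eq = trans (sym (∑-update c′ c j 1 at-j c′-off)) (+-comm (∑ c′) 1)

  weight : y ≡ ∑ (λ i → c′ i * a i)
  weight = +-cancelʳ-≡ (a j) _ _ (trans value (sym (∑-update _ _ j (a j) at-j off-j)))
    where
    at-j : c′ j * a j + a j ≡ c j * a j
    at-j = trans (cong (λ z → z * a j + a j) c′ⱼ)
                 (trans (+-comm (t * a j) (a j)) (cong (_* a j) (sym cⱼ)))
    off-j : ∀ i → i ≢ j → c′ i * a i ≡ c i * a i
    off-j i i≢j = cong (_* a i) (c′-off i i≢j)
... | zero = ⊥-elim (<-irrefl refl (≤-<-trans lower upper))
  where
  termwise : ∀ i → c i * a i ≤ c i * pred (a j)
  termwise i with i FP.≟ j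
  ... | yes refl rewrite cⱼ = z≤n
  ... | no i≢j = *-monoʳ-≤ (c i) (<⇒≤pred (maximal i i≢j))

  lower : suc h * a j ≤ ∑ (λ i → c i * a i)
  lower = begin
    suc h * a j    ≡⟨ +-comm (a j) (h * a j) ⟩
    h * a j + a j  ≤⟨ +-monoˡ-≤ (a j) large ⟩
    y + a j        ≡⟨ value ⟩
    ∑ (λ i → c i * a i) ∎
    where open ≤-Reasoning

  upper : ∑ (λ i → c i * a i) < suc h * a j
  upper = begin-strict
    ∑ (λ i → c i * a i) ≤⟨ ∑-weighted-≤ c a (pred (a j)) termwise ⟩
    ∑ c * pred (a j)    ≤⟨ *-monoˡ-≤ (pred (a j)) size ⟩
    suc h * pred (a j)  <⟨ *-monoʳ-< (suc h) (pred<self 1≤aⱼ) ⟩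
    suc h * a j         ∎
    where open ≤-Reasoning

last-maximal : ∀ {m} (a : Fin (suc m) → ℕ) → (∀ i j → i F.< j → a i < a j)
             → ∀ i → i ≢ fromℕ m → a i < a (fromℕ m)
last-maximal a increasing i i≢last =
  increasing i (fromℕ _) (FP.≤∧≢⇒< (FP.≤fromℕ i) i≢last)

last-positive : ∀ {m} (a : Fin (suc m) → ℕ) → a F.zero ≡ 1
              → (∀ i j → i F.< j → a i < a j) → 1 ≤ a (fromℕ m)
last-positive {zero}  a a₁≡1 increasing = ≤-reflexive (sym a₁≡1)
last-positive {suc m} a a₁≡1 increasing =
  subst (_≤ a (fromℕ (suc m))) a₁≡1 (<⇒≤ (last-maximal a increasing F.zero (λ ())))

module Shift (x H A : ℕ) where

  shift-large : ∀ h → H ≤ h → H * A ≤ x → h * A ≤ x + (h ∸ H) * A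
  shift-large h H≤h HA≤x = begin
    h * A                 ≡⟨ sym (cong (_* A) (m+[n∸m]≡n H≤h)) ⟩
    (H + (h ∸ H)) * A     ≡⟨ *-distribʳ-+ A H (h ∸ H) ⟩
    H * A + (h ∸ H) * A   ≤⟨ +-monoˡ-≤ _ HA≤x ⟩
    x + (h ∸ H) * A       ∎
    where open ≤-Reasoning

  shift-suc : ∀ h → H ≤ h → x + (suc h ∸ H) * A ≡ x + (h ∸ H) * A + A
  shift-suc h H≤h = begin
    x + (suc h ∸ H) * A     ≡⟨ cong (λ z → x + z * A) (+-∸-assoc 1 H≤h) ⟩
    x + (A + (h ∸ H) * A)   ≡⟨ cong (x +_) (+-comm A _) ⟩
    x + ((h ∸ H) * A + A)   ≡⟨ sym (+-assoc x _ A) ⟩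
    x + (h ∸ H) * A + A     ∎
    where open ≡-Reasoning

lemma1 : (m : ℕ) (a : Fin (suc m) → ℕ)
    → a F.zero ≡ 1
    → (∀ i j → i F.< j → a i < a j)
    → (n : ℕ → ℕ) → (∀ h → IsRange a h (n h))
    → (h₀ : ℕ) → 1 ≤ h₀ → a (fromℕ m) ≤ n h₀
    → (∀ h → 1 ≤ h → h < h₀ → n h < a (fromℕ m))
    → (h : ℕ) → h₀ ≤ h
    → (x : ℕ) → IsGap a n h₀ h x
    → x < (h₀ ∸ 1) * a (fromℕ m)
lemma1 m a a₁≡1 increasing n _ (suc H) _ _ _ (suc h) (s≤s H≤h) x (_ , unfilled , filled)
  with x <? H * a (fromℕ m)
... | yes x<HA = x<HA
... | no x≮HA = ⊥-elim (unfilled h H≤h ≤-refl shorter)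
  where
  open Shift x H (a (fromℕ m))
  shorter : HRep a h (x + (h ∸ H) * a (fromℕ m))
  shorter = peel a (fromℕ m) (last-positive a a₁≡1 increasing) (last-maximal a increasing)
                 h _ (shift-large h H≤h (≮⇒≥ x≮HA))
                 (subst (HRep a (suc h)) (shift-suc h H≤h) filled)
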